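{- Let $\mathcal{C}$ be a class of $\mathcal{L}$-frames, $\Phi$ a set of formulas, and $\mathcal{C}'=\{\mathfrak{F}\text{ an }\mathcal{L}_n\text{ -frame}:\mathfrak{F}_\sharp\in\mathcal{C}\}$. (1) If $\mathcal{C}'=\mathrm{Mod}(\Phi)$ then $\mathcal{C}=\mathrm{Mod}_n(\Phi)$. (2) If $\mathcal{C}=\mathrm{Mod}_n(\Phi)$ then $\mathcal{C}'\subseteq\mathrm{Mod}(\Phi)$; the reverse inclusion $\mathrm{Mod}(\Phi)\subseteq\mathcal{C}'$ need not hold.
   Context: Let $\mathcal{L}=\{\neg,\to,1\}\cup\{\nabla_i : i\in I\}$, each $\nabla_i$ $k_i$-ary ($k_i\ge1$); formulas built from an infinite set $\mathsf{Prop}$ by $\phi::=p\mid0\mid\neg\phi\mid\phi\to\phi\mid\nabla_i(\phi,\dots,\phi)$. Fix $n\ge1$; $\text{Ł}_n=\{0,\frac1n,\dots,1\}$ with $\neg x=1-x$, $x\to y=\min(1,1-x+y)$. An $\mathcal{L}$-frame is $\langle W,(R_i)\rangle$, $W\neq\emptyset$, $R_i\subseteq W^{k_i+1}$; $\mathbf{w}\in R_iu$ means $(u,w_1,\dots,w_{k_i})\in R_i$. An $\text{Ł}_n$-valued model is $\mathrm{Val}:W\times\mathsf{Prop}\to\text{Ł}_n$ extended by Łukasiewicz operations and $\mathrm{Val}(u,\nabla_i(\phi_1,\dots,\phi_k))=\min\{\max_\ell\mathrm{Val}(w_\ell,\phi_\ell):\mathbf{w}\in R_iu\}$ (empty min $=1$);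 $\mathfrak{F}\models_n\phi$ means $\phi$ has value $1$ everywhere in every such model; $\mathrm{Mod}_n(\Phi)$ is the class of $\mathcal{L}$-frames validating $\Phi$ in this sense. Write $m\preceq n$ for $m\mid n$. An $\mathcal{L}_n$-frame is $\langle W,(r_m)_{m\preceq n},(R_i)\rangle$ with $\langle W,(R_i)\rangle$ an $\mathcal{L}$-frame, $r_m\subseteq W$, $r_n=W$, $r_m\cap r_q=r_{\gcd(m,q)}$, $R_iu\subseteq r_m^{k_i}$ for $u\in r_m$; $\mathfrak{F}_\sharp$ is its $\mathcal{L}$-frame reduct. A model on an $\mathcal{L}_n$-frame is an $\text{Ł}_n$-valued model on the reduct with $\mathrm{Val}(u,p)\in\text{Ł}_m$ for $u\in r_m$; $\mathfrak{F}\models\phi$ means $\phi$ has value $1$ everywhere in all such models; $\mathrm{Mod}(\Phi)$ is the class of $\mathcal{L}_n$-frames validating $\Phi$. -}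

module Defs where

open import Data.Nat using (ℕ; zero; suc; _+_; _*_; _∸_; _≤_; _⊔_; _⊓_)
open import Data.Nat.Divisibility using (_∣_)
open import Data.Nat.GCD using (gcd)
open import Data.Fin using (Fin)
import Data.Fin as F
open import Data.Product using (_×_; Σ)
open import Relation.Binary.PropositionalEquality using (_≡_)
open import Function.Bundles using (_⇔_)

record Signature : Set₁ where
  field
    Idx   : Set
    ar    : Idx → ℕ
    ar≥1  : ∀ i → 1 ≤ ar i
open Signature public

data Fm (S : Signature) : Set where
  var  : ℕ → Fm S
  zer  : Fm S
  neg  : Fm S → Fm S
  imp  : Fm S → Fm S → Fm S
  nab  : (i : Idx S) → (Fin (ar S i) → Fm S) → Fm S

-- L-frames: nonempty W (witnessed by a point), Rᵢ ⊆ W^{kᵢ+1}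
-- (ws ∈ Rᵢ u  is  R i u ws).
record Frame (S : Signature) : Set₁ where
  field
    W     : Set
    point : W
    R     : (i : Idx S) → W → (Fin (ar S i) → W) → Set
open Frame public

maxF : (k : ℕ) → (Fin k → ℕ) → ℕ
maxF zero    f = 0
maxF (suc k) f = f F.zero ⊔ maxF k (λ l → f (F.suc l))

-- Truth values of Łₙ: the value j/n is represented by j ∈ {0,…,n}.
-- V is the extension of Val (on atoms) to all formulas by the Łukasiewicz
-- operations and the ∇-clause (the ∇ value is the greatest lower bound in
-- {0,…,n} of the maxima, so the empty min is n, i.e. 1).
record IsExt (n : ℕ) {S : Signature} (𝔉 : Frame S)
             (Val : W 𝔉 → ℕ → ℕ) (V : W 𝔉 → Fm S → ℕ) : Set where
  field
    e-var  : ∀ u p → V u (var p) ≡ Val u p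
    e-zer  : ∀ u → V u zer ≡ 0
    e-neg  : ∀ u φ → V u (neg φ) ≡ n ∸ V u φ
    e-imp  : ∀ u φ ψ → V u (imp φ ψ) ≡ n ⊓ ((n ∸ V u φ) + V u ψ)
    e-nab≤ : ∀ u i φs → V u (nab i φs) ≤ n
    e-nabl : ∀ u i φs ws → R 𝔉 i u ws →
               V u (nab i φs) ≤ maxF (ar S i) (λ l → V (ws l) (φs l))
    e-nabg : ∀ u i φs c → c ≤ n →
               (∀ ws → R 𝔉 i u ws → c ≤ maxF (ar S i) (λ l → V (ws l) (φs l))) →
               c ≤ V u (nab i φs)

_⊨[_]_ : {S : Signature} → Frame S → ℕ → Fm S → Set
_⊨[_]_ {S} 𝔉 n φ =
  (Val : W 𝔉 → ℕ → ℕ) → (∀ u p → Val u p ≤ n) →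
  (V : W 𝔉 → Fm S → ℕ) → IsExt n 𝔉 Val V → ∀ u → V u φ ≡ n

Modn : {S : Signature} → ℕ → (Fm S → Set) → Frame S → Set
Modn n Φ 𝔉 = ∀ φ → Φ φ → 𝔉 ⊨[ n ] φ

-- Lₙ-frames.  r m is only constrained (and only used) for m ∣ n.
record LnFrame (n : ℕ) (S : Signature) : Set₁ where
  field
    frame  : Frame S
    r      : ℕ → W frame → Set
    r-top  : ∀ u → r n u
    r-gcd  : ∀ m q → m ∣ n → q ∣ n → ∀ u → (r m u × r q u) ⇔ r (gcd m q) u
    r-R    : ∀ m → m ∣ n → ∀ i u ws → r m u → R frame i u ws → ∀ l → r m (ws l)
open LnFrame public

♯ : {n : ℕ} {S : Signature} → LnFrame n S → Frame S
♯ 𝔉 = frame 𝔉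

-- validity on an Lₙ-frame: Val(u,p) ∈ Łₘ for u ∈ rₘ (m ∣ n).
-- (j/n ∈ Łₘ  iff  n ∣ j·m.)
_⊨ₗ_ : {n : ℕ} {S : Signature} → LnFrame n S → Fm S → Set
_⊨ₗ_ {n} {S} 𝔉 φ =
  (Val : W (frame 𝔉) → ℕ → ℕ) → (∀ u p → Val u p ≤ n) →
  (∀ m → m ∣ n → ∀ u → r 𝔉 m u → ∀ p → n ∣ Val u p * m) →
  (V : W (frame 𝔉) → Fm S → ℕ) → IsExt n (frame 𝔉) Val V → ∀ u → V u φ ≡ n

Mod : {n : ℕ} {S : Signature} → (Fm S → Set) → LnFrame n S → Set
Mod Φ 𝔉 = ∀ φ → Φ φ → 𝔉 ⊨ₗ φ

Lift : {n : ℕ} {S : Signature} → (Frame S → Set) → LnFrame n S → Set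
Lift 𝒞 𝔉 = 𝒞 (♯ 𝔉)

-- Models on an Lₙ-frame are the Łₙ-valued models on its reduct whose atoms take values in Łₘ
-- at the worlds of rₘ, so Łₙ-validity on 𝔉♯ always implies validity on 𝔉; this gives (2).
-- Conversely, an L-frame becomes an Lₙ-frame with no world in a proper rₘ, and on that frame
-- the two notions of validity coincide; this gives (1). The reverse inclusion in (2) fails:
-- excluded middle p ∨ ¬p holds on an L₂-frame all of whose worlds lie in r₁ (atoms are then
-- 0 or 1), but not on its reduct, where p may take the value 1/2.
module Submission where

open import Defs
open import Data.Nat using (ℕ; suc; _≤_; _⊓_; _⊔_; _+_; _*_; _∸_; s≤s; z≤n)
open import Data.Nat.Properties
  using (≤-total; +-monoʳ-≤; m∸n≤m; m∸n+n≡m; m∸[m∸n]≡n; ∸-+-assoc; n∸n≡0;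
         m≤n⇒m⊓n≡m; m≥n⇒m⊓n≡n; m≤n⇒m⊔n≡n; m≥n⇒m⊔n≡m)
open import Data.Nat.Divisibility using (_∣_; ∣-refl; ∣-trans; ∣n⇒∣m*n; ∣⇒≤; 1∣_)
open import Data.Nat.GCD using (gcd[m,n]∣m; gcd[m,n]∣n; gcd-greatest)
open import Data.Product using (_×_; _,_)
open import Data.Sum using (inj₁; inj₂)
open import Data.Empty using (⊥)
open import Data.Unit using (⊤; tt)
open import Relation.Nullary using (¬_)
open import Relation.Binary.PropositionalEquality using (_≡_; refl; trans; subst; cong; cong₂; module ≡-Reasoning)
open import Function.Bundles using (_⇔_; mk⇔; Equivalence)

private
  variable
    n : ℕ
    S : Signature

unconstrained : (n : ℕ) → Frame S → LnFrame n S
unconstrained n 𝔉 = record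
  { frame = 𝔉
  ; r     = λ m _ → n ∣ m
  ; r-top = λ _ → ∣-refl
  ; r-gcd = λ m q _ _ _ → mk⇔ (λ (n∣m , n∣q) → gcd-greatest n∣m n∣q)
                              (λ n∣g → ∣-trans n∣g (gcd[m,n]∣m m q) , ∣-trans n∣g (gcd[m,n]∣n m q))
  ; r-R   = λ _ _ _ _ _ n∣m _ _ → n∣m
  }

boolean : (n : ℕ) → Frame S → LnFrame n S
boolean n 𝔉 = record
  { frame = 𝔉
  ; r     = λ _ _ → ⊤
  ; r-top = λ _ → tt
  ; r-gcd = λ _ _ _ _ _ → mk⇔ (λ _ → tt) (λ _ → tt , tt)
  ; r-R   = λ _ _ _ _ _ _ _ _ → tt
  }

Modn⇒Mod : {Φ : Fm S → Set} (𝔉 : LnFrame n S) → Modn n Φ (♯ 𝔉) → Mod Φ 𝔉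
Modn⇒Mod 𝔉 valid φ φ∈Φ Val bounded _ = valid φ φ∈Φ Val bounded

Mod-unconstrained⇒Modn : {Φ : Fm S → Set} (𝔉 : Frame S) → Mod Φ (unconstrained n 𝔉) → Modn n Φ 𝔉
Mod-unconstrained⇒Modn 𝔉 valid φ φ∈Φ Val bounded =
  valid φ φ∈Φ Val bounded (λ _ _ u n∣m p → ∣n⇒∣m*n (Val u p) n∣m)

_∨_ : Fm S → Fm S → Fm S
φ ∨ ψ = imp (imp φ ψ) ψ

excludedMiddle : ℕ → Fm S
excludedMiddle p = var p ∨ neg (var p)

łukasiewicz-∨ : ∀ {a b} → a ≤ n → b ≤ n → n ⊓ ((n ∸ (n ⊓ ((n ∸ a) + b))) + b) ≡ a ⊔ b
łukasiewicz-∨ {n} {a} {b} a≤n b≤n with ≤-total a b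
... | inj₁ a≤b = begin
  n ⊓ ((n ∸ (n ⊓ ((n ∸ a) + b))) + b) ≡⟨ cong (λ x → n ⊓ ((n ∸ x) + b)) (m≤n⇒m⊓n≡m n≤n∸a+b) ⟩
  n ⊓ ((n ∸ n) + b)                    ≡⟨ cong (λ x → n ⊓ (x + b)) (n∸n≡0 n) ⟩
  n ⊓ b                                ≡⟨ m≥n⇒m⊓n≡n b≤n ⟩
  b                                    ≡⟨ m≤n⇒m⊔n≡n a≤b ⟨
  a ⊔ b                                ∎
  where
  open ≡-Reasoning
  n≤n∸a+b : n ≤ (n ∸ a) + b
  n≤n∸a+b = subst (_≤ (n ∸ a) + b) (m∸n+n≡m a≤n) (+-monoʳ-≤ (n ∸ a) a≤b)
... | inj₂ b≤a = begin
  n ⊓ ((n ∸ (n ⊓ ((n ∸ a) + b))) + b) ≡⟨ cong (λ x → n ⊓ ((n ∸ x) + b)) (m≥n⇒m⊓n≡n n∸a+b≤n) ⟩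
  n ⊓ ((n ∸ ((n ∸ a) + b)) + b)        ≡⟨ cong (λ x → n ⊓ (x + b)) (∸-+-assoc n (n ∸ a) b) ⟨
  n ⊓ ((n ∸ (n ∸ a) ∸ b) + b)          ≡⟨ cong (λ x → n ⊓ ((x ∸ b) + b)) (m∸[m∸n]≡n a≤n) ⟩
  n ⊓ ((a ∸ b) + b)                    ≡⟨ cong (n ⊓_) (m∸n+n≡m b≤a) ⟩
  n ⊓ a                                ≡⟨ m≥n⇒m⊓n≡n a≤n ⟩
  a                                    ≡⟨ m≥n⇒m⊔n≡m b≤a ⟨
  a ⊔ b                                ∎
  where
  open ≡-Reasoning
  n∸a+b≤n : (n ∸ a) + b ≤ n
  n∸a+b≤n = subst ((n ∸ a) + b ≤_) (m∸n+n≡m a≤n) (+-monoʳ-≤ (n ∸ a) b≤a)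

∨-value : {𝔉 : Frame S} {Val : W 𝔉 → ℕ → ℕ} {V : W 𝔉 → Fm S → ℕ} → IsExt n 𝔉 Val V →
          ∀ u φ ψ → V u φ ≤ n → V u ψ ≤ n → V u (φ ∨ ψ) ≡ V u φ ⊔ V u ψ
∨-value {n = n} {V = V} ext u φ ψ φ≤n ψ≤n = begin
  V u (φ ∨ ψ)                                        ≡⟨ e-imp u (imp φ ψ) ψ ⟩
  n ⊓ ((n ∸ V u (imp φ ψ)) + V u ψ)                  ≡⟨ cong (λ x → n ⊓ ((n ∸ x) + V u ψ)) (e-imp u φ ψ) ⟩
  n ⊓ ((n ∸ (n ⊓ ((n ∸ V u φ) + V u ψ))) + V u ψ)   ≡⟨ łukasiewicz-∨ φ≤n ψ≤n ⟩
  V u φ ⊔ V u ψ                                      ∎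
  where
  open ≡-Reasoning
  open IsExt ext

excludedMiddle-value : {𝔉 : Frame S} {Val : W 𝔉 → ℕ → ℕ} {V : W 𝔉 → Fm S → ℕ} → IsExt n 𝔉 Val V →
                       ∀ u p → Val u p ≤ n → V u (excludedMiddle p) ≡ Val u p ⊔ (n ∸ Val u p)
excludedMiddle-value {n = n} {Val = Val} {V = V} ext u p Val≤n = begin
  V u (excludedMiddle p)           ≡⟨ ∨-value ext u (var p) (neg (var p)) V[p]≤n V[¬p]≤n ⟩
  V u (var p) ⊔ V u (neg (var p))  ≡⟨ cong₂ _⊔_ (e-var u p) (trans (e-neg u (var p)) (cong (n ∸_) (e-var u p))) ⟩
  Val u p ⊔ (n ∸ Val u p)          ∎
  where
  open ≡-Reasoning
  open IsExt ext
  V[p]≤n : V u (var p) ≤ n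
  V[p]≤n rewrite e-var u p = Val≤n
  V[¬p]≤n : V u (neg (var p)) ≤ n
  V[¬p]≤n rewrite e-neg u (var p) = m∸n≤m n (V u (var p))

2∣v⇒v⊔[2∸v]≡2 : ∀ v → v ≤ 2 → 2 ∣ v * 1 → v ⊔ (2 ∸ v) ≡ 2
2∣v⇒v⊔[2∸v]≡2 0 _ _ = refl
2∣v⇒v⊔[2∸v]≡2 1 _ 2∣1 with ∣⇒≤ 2∣1
... | s≤s ()
2∣v⇒v⊔[2∸v]≡2 2 _ _ = refl
2∣v⇒v⊔[2∸v]≡2 (suc (suc (suc _))) (s≤s (s≤s ())) _

excludedMiddle-valid-boolean : (𝔉 : Frame S) (p : ℕ) → boolean 2 𝔉 ⊨ₗ excludedMiddle p
excludedMiddle-valid-boolean 𝔉 p Val bounded inŁₘ V ext u =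
  trans (excludedMiddle-value ext u p (bounded u p))
        (2∣v⇒v⊔[2∸v]≡2 (Val u p) (bounded u p) (inŁₘ 1 (1∣ 2) u tt p))

S∅ : Signature
S∅ = record { Idx = ⊥ ; ar = λ () ; ar≥1 = λ () }

𝟙 : Frame S∅
𝟙 = record { W = ⊤ ; point = tt ; R = λ () }

evaluate : ℕ → (ℕ → ℕ) → Fm S∅ → ℕ
evaluate n val (var p)   = val p
evaluate n val zer       = 0
evaluate n val (neg φ)   = n ∸ evaluate n val φ
evaluate n val (imp φ ψ) = n ⊓ ((n ∸ evaluate n val φ) + evaluate n val ψ)
evaluate n val (nab () _)

evaluate-isExt : (val : ℕ → ℕ) → IsExt n 𝟙 (λ _ → val) (λ _ → evaluate n val)
evaluate-isExt val = record
  { e-var  = λ _ _ → refl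
  ; e-zer  = λ _ → refl
  ; e-neg  = λ _ _ → refl
  ; e-imp  = λ _ _ _ → refl
  ; e-nab≤ = λ _ ()
  ; e-nabl = λ _ ()
  ; e-nabg = λ _ ()
  }

excludedMiddle-invalid : (p : ℕ) → ¬ (𝟙 ⊨[ 2 ] excludedMiddle p)
excludedMiddle-invalid p valid with valid (λ _ _ → 1) (λ _ _ → s≤s z≤n) _ (evaluate-isExt (λ _ → 1)) tt
... | ()

proposition2p12 : ((n : ℕ) → 1 ≤ n → (S : Signature) → (𝒞 : Frame S → Set) → (Φ : Fm S → Set) →
    (((𝔉 : LnFrame n S) → Lift 𝒞 𝔉 ⇔ Mod Φ 𝔉) → (𝔉 : Frame S) → 𝒞 𝔉 ⇔ Modn n Φ 𝔉)
    × (((𝔉 : Frame S) → 𝒞 𝔉 ⇔ Modn n Φ 𝔉) → (𝔉 : LnFrame n S) → Lift 𝒞 𝔉 → Mod Φ 𝔉))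
    × ¬ ((n : ℕ) → 1 ≤ n → (S : Signature) → (𝒞 : Frame S → Set) → (Φ : Fm S → Set) →
    ((𝔉 : Frame S) → 𝒞 𝔉 ⇔ Modn n Φ 𝔉) → (𝔉 : LnFrame n S) → Mod Φ 𝔉 → Lift 𝒞 𝔉)
proposition2p12 = (λ n _ S 𝒞 Φ → part₁ n 𝒞 Φ , part₂ n 𝒞 Φ) , reverse-fails
  where
  part₁ : (n : ℕ) (𝒞 : Frame S → Set) (Φ : Fm S → Set) →
          ((𝔉 : LnFrame n S) → Lift 𝒞 𝔉 ⇔ Mod Φ 𝔉) → (𝔉 : Frame S) → 𝒞 𝔉 ⇔ Modn n Φ 𝔉
  part₁ n 𝒞 Φ 𝒞′≡Mod 𝔉 = mk⇔
    (λ 𝔉∈𝒞 → Mod-unconstrained⇒Modn 𝔉 (to (𝒞′≡Mod (unconstrained n 𝔉)) 𝔉∈𝒞))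
    (λ valid → from (𝒞′≡Mod (unconstrained n 𝔉)) (Modn⇒Mod (unconstrained n 𝔉) valid))
    where open Equivalence

  part₂ : (n : ℕ) (𝒞 : Frame S → Set) (Φ : Fm S → Set) →
          ((𝔉 : Frame S) → 𝒞 𝔉 ⇔ Modn n Φ 𝔉) → (𝔉 : LnFrame n S) → Lift 𝒞 𝔉 → Mod Φ 𝔉
  part₂ n 𝒞 Φ 𝒞≡Modn 𝔉 𝔉♯∈𝒞 = Modn⇒Mod 𝔉 (Equivalence.to (𝒞≡Modn (♯ 𝔉)) 𝔉♯∈𝒞)

  reverse-fails : ¬ ((n : ℕ) → 1 ≤ n → (S : Signature) → (𝒞 : Frame S → Set) → (Φ : Fm S → Set) →
                  ((𝔉 : Frame S) → 𝒞 𝔉 ⇔ Modn n Φ 𝔉) → (𝔉 : LnFrame n S) → Mod Φ 𝔉 → Lift 𝒞 𝔉)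
  reverse-fails reverse = excludedMiddle-invalid 0 (reverse 2 (s≤s z≤n) S∅ (Modn 2 EM) EM
    (λ _ → mk⇔ (λ valid → valid) (λ valid → valid)) (boolean 2 𝟙)
    (λ { _ refl → excludedMiddle-valid-boolean 𝟙 0 }) _ refl)
    where
    EM : Fm S∅ → Set
    EM φ = φ ≡ excludedMiddle 0
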